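{- Let $\sigma\le\pi$ be permutations. Suppose that for each $\tau\in[\sigma,\pi]$ a subset $\mathcal{NE}(\tau,\pi)\subseteq\mathcal{E}(\tau,\pi)$ is fixed (its elements called normal embeddings), with $\mathcal{NE}(\pi,\pi)=\mathcal{E}(\pi,\pi)$. For each $\lambda\in[\sigma,\pi)$ let \[\mathcal{NE}_\lambda(\mathrm{odd},\pi)=\bigcup_{\tau\in[\lambda,\pi],\ |\tau|\text{ odd}}\mathcal{NE}(\tau,\pi),\qquad \mathcal{NE}_\lambda(\mathrm{even},\pi)=\bigcup_{\tau\in[\lambda,\pi],\ |\tau|\text{ even}}\mathcal{NE}(\tau,\pi).\] If for every $\lambda\in[\sigma,\pi)$ with $\mu[\sigma,\lambda]\neq0$ we have $|\mathcal{NE}_\lambda(\mathrm{odd},\pi)|=|\mathcal{NE}_\lambda(\mathrm{even},\pi)|$, then $\mu[\sigma,\pi]=(-1)^{|\pi|-|\sigma|}\,|\mathcal{NE}(\sigma,\pi)|$.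
   Context: Permutations (including the empty permutation) are ordered by containment: $\sigma\le\pi$ if $\pi$ has a subsequence order-isomorphic to $\sigma$. $[\sigma,\pi]=\{\tau:\sigma\le\tau\le\pi\}$, $[\sigma,\pi)=\{\tau:\sigma\le\tau<\pi\}$. The Möbius function: $\mu[\sigma,\pi]=0$ if $\sigma\not\le\pi$, $\mu[\sigma,\pi]=1$ if $\sigma=\pi$, and $\mu[\sigma,\pi]=-\sum_{\tau\in[\sigma,\pi)}\mu[\sigma,\tau]$ otherwise. For $\tau$ of length $k$ and $\pi$ of length $n$, an embedding of $\tau$ into $\pi$ is a function $f\colon\{1,\dots,k\}\to\{1,\dots,n\}$ with $f(1)<\dots<f(k)$ such that $\tau_a<\tau_b\iff\pi_{f(a)}<\pi_{f(b)}$ for all $a,b$; $\mathcal{E}(\tau,\pi)$ is the set of such embeddings (embeddings of different permutations $\tau$ are regarded as distinct objects, so the unions above are disjoint). -}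

module Defs where

open import Data.Nat using (ℕ; zero; suc; _<ᵇ_; _∸_)
import Data.Nat.Properties as ℕP
open import Data.Bool using (Bool; true; false; _∧_; not; if_then_else_; T)
open import Data.List using (List; []; _∷_; _++_; length; map; concatMap; upTo; null; filterᵇ)
open import Data.Nat.ListAction using (sum)
open import Data.Bool.ListAction using (and)
import Data.List.Properties as LP
open import Data.List.Relation.Binary.Permutation.Propositional using (_↭_)
open import Data.Integer using (ℤ; +_; -_; _^_) renaming (_+_ to _+ℤ_)
open import Relation.Nullary using (does)

-- Permutations of length n are represented as lists of naturals that are
-- a rearrangement of [0, 1, ..., n-1] (one-line notation, 0-based values).
IsPerm : List ℕ → Set
IsPerm π = π ↭ upTo (length π)

-- i-th entry (0-based), default 0 out of range (never used out of range)
at : List ℕ → ℕ → ℕ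
at []       _       = 0
at (x ∷ _)  zero    = x
at (_ ∷ xs) (suc i) = at xs i

_==ᵇ_ : Bool → Bool → Bool
true  ==ᵇ b = b
false ==ᵇ b = not b

_≡ˡ?_ : List ℕ → List ℕ → Bool
xs ≡ˡ? ys = does (LP.≡-dec ℕP._≟_ xs ys)

insertions : ℕ → List ℕ → List (List ℕ)
insertions x []       = (x ∷ []) ∷ []
insertions x (y ∷ ys) = (x ∷ y ∷ ys) ∷ map (y ∷_) (insertions x ys)

perms : ℕ → List (List ℕ)
perms zero    = [] ∷ []
perms (suc k) = concatMap (insertions k) (perms k)

permsBelow : ℕ → List (List ℕ)
permsBelow n = concatMap perms (upTo n)

choose : ℕ → List ℕ → List (List ℕ)
choose zero    _        = [] ∷ []
choose (suc k) []       = []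
choose (suc k) (x ∷ xs) = map (x ∷_) (choose k xs) ++ choose (suc k) xs

-- An embedding f : {1..k} → {1..n} of τ into π is represented by the list
-- [f(1), ..., f(k)] of (0-based) positions; it is strictly increasing by
-- construction (from 'choose'), and the order condition
-- τ_a < τ_b ⇔ π_{f(a)} < π_{f(b)} is checked for all a, b.
isEmb : List ℕ → List ℕ → List ℕ → Bool
isEmb τ π ps =
  and (concatMap (λ a → map (λ b →
        (at τ a <ᵇ at τ b) ==ᵇ (at π (at ps a) <ᵇ at π (at ps b)))
      (upTo (length τ))) (upTo (length τ)))

embs : List ℕ → List ℕ → List (List ℕ)
embs τ π = filterᵇ (isEmb τ π) (choose (length τ) (upTo (length π)))

_≤ᵇ_ : List ℕ → List ℕ → Bool
σ ≤ᵇ π = not (null (embs σ π))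

_≼_ : List ℕ → List ℕ → Set
σ ≼ π = T (σ ≤ᵇ π)

sumℤ : List ℤ → ℤ
sumℤ []       = + 0
sumℤ (x ∷ xs) = x +ℤ sumℤ xs

-- Möbius function, by the defining recursion.  The fuel argument only
-- ensures termination: μ σ π uses fuel |π|+1, and every τ in [σ,π) has
-- |τ| < |π| (so [σ,π) = {τ : |τ| < |π|, σ ≤ τ ≤ π}).
mobF : ℕ → List ℕ → List ℕ → ℤ
mobF zero    σ π = + 0
mobF (suc f) σ π =
  if σ ≡ˡ? π then + 1
  else if σ ≤ᵇ π
    then - sumℤ (map (mobF f σ)
                  (filterᵇ (λ τ → (σ ≤ᵇ τ) ∧ (τ ≤ᵇ π)) (permsBelow (length π))))
    else + 0

μ : List ℕ → List ℕ → ℤ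
μ σ π = mobF (suc (length π)) σ π

-- the closed interval [λ, π] (every τ ≤ π has |τ| ≤ |π|)
interval : List ℕ → List ℕ → List (List ℕ)
interval λ′ π = filterᵇ (λ τ → (λ′ ≤ᵇ τ) ∧ (τ ≤ᵇ π)) (permsBelow (suc (length π)))

isOdd : ℕ → Bool
isOdd zero    = false
isOdd (suc n) = not (isOdd n)

-- A choice of normal embeddings into π: ne τ e = true iff the embedding e
-- of τ into π is normal.  𝒩ℰ(τ,π) = {e ∈ ℰ(τ,π) : ne τ e = true}.
NE : (List ℕ → List ℕ → Bool) → List ℕ → List ℕ → List (List ℕ)
NE ne τ π = filterᵇ (ne τ) (embs τ π)

-- |𝒩ℰ_λ(odd, π)| and |𝒩ℰ_λ(even, π)| (disjoint unions, so sizes add)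
NEoddCount : (List ℕ → List ℕ → Bool) → List ℕ → List ℕ → ℕ
NEoddCount ne λ′ π =
  sum (map (λ τ → length (NE ne τ π)) (filterᵇ (λ τ → isOdd (length τ)) (interval λ′ π)))

NEevenCount : (List ℕ → List ℕ → Bool) → List ℕ → List ℕ → ℕ
NEevenCount ne λ′ π =
  sum (map (λ τ → length (NE ne τ π)) (filterᵇ (λ τ → not (isOdd (length τ))) (interval λ′ π)))

-- Put s(τ) = (-1)^|τ| |NE(τ,π)| and g(λ) = Σ_{τ∈[λ,π]} s(τ).  For ANY weight s,
-- exchanging the order of summation and using the defining recursion of μ,
-- Σ_{λ∈[σ,τ]} μ[σ,λ] = [τ = σ], gives the inversion identity
--      Σ_{λ∈[σ,π]} μ[σ,λ] g(λ) = s(σ)                       (μ-inversion).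
-- For λ ≠ π, g(λ) = |NE_λ(even,π)| - |NE_λ(odd,π)|, so by hypothesis every
-- term with μ[σ,λ] ≠ 0 other than λ = π vanishes; and since NE(π,π) is the
-- identity alone, g(π) = (-1)^|π|.  Hence μ[σ,π] (-1)^|π| = (-1)^|σ| |NE(σ,π)|.
module Submission where

open import Defs
open import Data.Nat using (ℕ; _∸_)
open import Data.Bool using (Bool; true)
open import Data.List using (List; length)
open import Data.List.Membership.Propositional using (_∈_)
open import Data.Integer using (ℤ; +_; -_; _*_; _^_)
open import Relation.Binary.PropositionalEquality using (_≡_; _≢_)
open import Relation.Nullary using (¬_)

open import Data.Nat using (zero; suc; _<ᵇ_; _≤_; _<_; z≤n; s≤s; _⊓_; _+_)
import Data.Nat.Properties as ℕP
open import Data.Bool using (false; _∧_; not; if_then_else_; T; T?)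
open import Data.List using ([]; _∷_; _++_; map; concatMap; upTo; applyUpTo; filterᵇ)
open import Data.Nat.ListAction using (sum)
open import Data.Bool.ListAction using (and)
import Data.List.Properties as LP
open import Data.List.Membership.Propositional using (_∉_; find)
import Data.List.Membership.Propositional.Properties as MP
open import Data.List.Relation.Unary.Any using (here; there)
import Data.List.Relation.Unary.Any as Any
open import Data.List.Relation.Binary.Permutation.Propositional
  using (_↭_; ↭-sym; ↭-trans; ↭-refl; prep; swap; ↭-reflexive)
import Data.List.Relation.Binary.Permutation.Propositional.Properties as PP
open import Data.Integer using () renaming (_+_ to _+ℤ_)
import Data.Integer.Properties as ZP
open import Relation.Binary.PropositionalEquality
  using (refl; sym; trans; cong; cong₂; subst; subst₂; module ≡-Reasoning)
open import Relation.Nullary using (yes; no; does)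
open import Relation.Nullary.Decidable using (dec-true; dec-false)
open import Data.Product using (Σ; _×_; _,_; proj₁; proj₂; map₂)
open import Data.Sum using (_⊎_; inj₁; inj₂)
open import Data.Empty using (⊥-elim)
open import Function using (_∘_; case_of_)
open import Data.Integer.Tactic.RingSolver using (solve-∀)

∑ : {A : Set} → List A → (A → ℤ) → ℤ
∑ L f = sumℤ (map f L)

when : Bool → ℤ → ℤ
when b x = if b then x else + 0

∑-cong : {A : Set} (L : List A) {f g : A → ℤ} → (∀ x → x ∈ L → f x ≡ g x) → ∑ L f ≡ ∑ L g
∑-cong []      h = refl
∑-cong (x ∷ L) h = cong₂ _+ℤ_ (h x (here refl)) (∑-cong L (λ y y∈ → h y (there y∈)))

∑-zero : {A : Set} (L : List A) {f : A → ℤ} → (∀ x → x ∈ L → f x ≡ + 0) → ∑ L f ≡ + 0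
∑-zero []      h = refl
∑-zero (x ∷ L) h rewrite h x (here refl) | ∑-zero L (λ y y∈ → h y (there y∈)) = refl

∑-++ : {A : Set} (L M : List A) (f : A → ℤ) → ∑ (L ++ M) f ≡ ∑ L f +ℤ ∑ M f
∑-++ []      M f = sym (ZP.+-identityˡ _)
∑-++ (x ∷ L) M f rewrite ∑-++ L M f = sym (ZP.+-assoc (f x) _ _)

∑-+ : {A : Set} (L : List A) (f g : A → ℤ) → ∑ L (λ x → f x +ℤ g x) ≡ ∑ L f +ℤ ∑ L g
∑-+ []      f g = refl
∑-+ (x ∷ L) f g rewrite ∑-+ L f g = interchange (f x) (g x) (∑ L f) (∑ L g)
  where
  interchange : ∀ a b c d → a +ℤ b +ℤ (c +ℤ d) ≡ a +ℤ c +ℤ (b +ℤ d)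
  interchange = solve-∀

∑-neg : {A : Set} (L : List A) (f : A → ℤ) → ∑ L (λ x → - f x) ≡ - ∑ L f
∑-neg []      f = refl
∑-neg (x ∷ L) f rewrite ∑-neg L f = sym (ZP.neg-distrib-+ (f x) (∑ L f))

∑-*ˡ : {A : Set} (L : List A) (c : ℤ) (f : A → ℤ) → ∑ L (λ x → c * f x) ≡ c * ∑ L f
∑-*ˡ []      c f = sym (ZP.*-zeroʳ c)
∑-*ˡ (x ∷ L) c f rewrite ∑-*ˡ L c f = sym (ZP.*-distribˡ-+ c (f x) (∑ L f))

∑-swap : {A B : Set} (L : List A) (M : List B) (f : A → B → ℤ) →
  ∑ L (λ x → ∑ M (f x)) ≡ ∑ M (λ y → ∑ L (λ x → f x y))
∑-swap []      M f = sym (∑-zero M (λ _ _ → refl))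
∑-swap (x ∷ L) M f rewrite ∑-swap L M f = sym (∑-+ M (f x) (λ y → ∑ L (λ x → f x y)))

+sum≡∑ : {A : Set} (L : List A) (f : A → ℕ) → + sum (map f L) ≡ ∑ L (λ x → + f x)
+sum≡∑ []      f = refl
+sum≡∑ (x ∷ L) f = trans (ZP.pos-+ (f x) (sum (map f L))) (cong (+ f x +ℤ_) (+sum≡∑ L f))

∑-concatMap : {A B : Set} (h : A → List B) (L : List A) (f : B → ℤ) →
  ∑ (concatMap h L) f ≡ ∑ L (λ x → ∑ (h x) f)
∑-concatMap h []      f = refl
∑-concatMap h (x ∷ L) f =
  trans (∑-++ (h x) (concatMap h L) f) (cong (∑ (h x) f +ℤ_) (∑-concatMap h L f))

*-when : ∀ b (m y : ℤ) → m * when b y ≡ when b (m * y)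
*-when true  m y = refl
*-when false m y = ZP.*-zeroʳ m

when-*∑ : {A : Set} → ∀ b (m : ℤ) (L : List A) (f : A → ℤ) →
  when b (m * ∑ L f) ≡ ∑ L (λ x → when b (m * f x))
when-*∑ true  m L f = sym (∑-*ˡ L m f)
when-*∑ false m L f = sym (∑-zero L (λ _ _ → refl))

filterᵇ-cons : {A : Set} (p : A → Bool) (x : A) (xs : List A) →
  filterᵇ p (x ∷ xs) ≡ (if p x then x ∷ filterᵇ p xs else filterᵇ p xs)
filterᵇ-cons p x xs with p x
... | true  = refl
... | false = refl

T→≡ : {b : Bool} → T b → b ≡ true
T→≡ {true} _ = refl

≡→T : {b : Bool} → b ≡ true → T b
≡→T refl = _

∈-filterᵇ⁻ : {A : Set} (p : A → Bool) {L : List A} {x : A} →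
  x ∈ filterᵇ p L → x ∈ L × p x ≡ true
∈-filterᵇ⁻ p m = map₂ T→≡ (MP.∈-filter⁻ (T? ∘ p) m)

∈-filterᵇ⁺ : {A : Set} (p : A → Bool) {L : List A} {x : A} →
  x ∈ L → p x ≡ true → x ∈ filterᵇ p L
∈-filterᵇ⁺ p m px = MP.∈-filter⁺ (T? ∘ p) m (≡→T px)

∑-filter : {A : Set} (p : A → Bool) (L : List A) (f : A → ℤ) →
  ∑ (filterᵇ p L) f ≡ ∑ L (λ x → when (p x) (f x))
∑-filter p []      f = refl
∑-filter p (x ∷ L) f rewrite filterᵇ-cons p x L with p x
... | true  = cong (f x +ℤ_) (∑-filter p L f)
... | false = sym (trans (ZP.+-identityˡ _) (sym (∑-filter p L f)))

length-filterᵇ-cons : {A : Set} (p : A → Bool) (x : A) (xs : List A) →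
  length (filterᵇ p (x ∷ xs)) ≡ (if p x then 1 else 0) + length (filterᵇ p xs)
length-filterᵇ-cons p x xs rewrite filterᵇ-cons p x xs with p x
... | true  = refl
... | false = refl

length-filterᵇ-map : {A B : Set} (p : B → Bool) (f : A → B) (L : List A) →
  length (filterᵇ p (map f L)) ≡ length (filterᵇ (p ∘ f) L)
length-filterᵇ-map p f []      = refl
length-filterᵇ-map p f (x ∷ L)
  rewrite length-filterᵇ-cons p (f x) (map f L) | length-filterᵇ-cons (p ∘ f) x L
        | length-filterᵇ-map p f L = refl

filterᵇ-cong : {A : Set} (p q : A → Bool) (L : List A) →
  (∀ x → x ∈ L → p x ≡ q x) → filterᵇ p L ≡ filterᵇ q L
filterᵇ-cong p q []      h = refl
filterᵇ-cong p q (x ∷ L) h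
  rewrite filterᵇ-cons p x L | filterᵇ-cons q x L | h x (here refl)
        | filterᵇ-cong p q L (λ y m → h y (there m)) = refl

∧-true : ∀ {a b} → (a ∧ b) ≡ true → a ≡ true × b ≡ true
∧-true {true} {true} _ = refl , refl

when-∧-zero : ∀ a b (x : ℤ) → ¬ (a ≡ true × b ≡ true) → when (a ∧ b) x ≡ + 0
when-∧-zero true  true  x h = ⊥-elim (h (refl , refl))
when-∧-zero true  false x h = refl
when-∧-zero false b     x h = refl

≡ˡ?-sound : (xs ys : List ℕ) → (xs ≡ˡ? ys) ≡ true → xs ≡ ys
≡ˡ?-sound xs ys h with LP.≡-dec ℕP._≟_ xs ys
... | yes e = e

≡ˡ?-complete : {xs ys : List ℕ} → xs ≡ ys → (xs ≡ˡ? ys) ≡ true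
≡ˡ?-complete {xs} {ys} e = dec-true (LP.≡-dec ℕP._≟_ xs ys) e

≡ˡ?-false : {xs ys : List ℕ} → xs ≢ ys → (xs ≡ˡ? ys) ≡ false
≡ˡ?-false {xs} {ys} e = dec-false (LP.≡-dec ℕP._≟_ xs ys) e

mult : List ℕ → List (List ℕ) → ℤ
mult a L = ∑ L (λ x → when (x ≡ˡ? a) (+ 1))

collapse : (a : List ℕ) (L : List (List ℕ)) (h : List ℕ → ℤ) (c : ℤ) →
  (∀ x → x ∈ L → h x ≡ when (x ≡ˡ? a) c) → ∑ L h ≡ mult a L * c
collapse a []      h c H = refl
collapse a (x ∷ L) h c H
  rewrite H x (here refl) | collapse a L h c (λ y y∈ → H y (there y∈)) with x ≡ˡ? a
... | true  = hit c (mult a L)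
  where hit : ∀ c m → c +ℤ m * c ≡ (+ 1 +ℤ m) * c
        hit = solve-∀
... | false = miss c (mult a L)
  where miss : ∀ c m → + 0 +ℤ m * c ≡ (+ 0 +ℤ m) * c
        miss = solve-∀

collapse₁ : (a : List ℕ) (L : List (List ℕ)) (h : List ℕ → ℤ) (c : ℤ) →
  mult a L ≡ + 1 → (∀ x → x ∈ L → h x ≡ when (x ≡ˡ? a) c) → ∑ L h ≡ c
collapse₁ a L h c once H =
  trans (collapse a L h c H) (trans (cong (_* c) once) (ZP.*-identityˡ c))

mult-filter : ∀ (q : List ℕ → Bool) a L → q a ≡ true → mult a (filterᵇ q L) ≡ mult a L
mult-filter q a L qa = trans (∑-filter q L (λ x → when (x ≡ˡ? a) (+ 1))) (∑-cong L λ x _ → guard x)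
  where
  guard : ∀ x → when (q x) (when (x ≡ˡ? a) (+ 1)) ≡ when (x ≡ˡ? a) (+ 1)
  guard x with x ≡ˡ? a in e
  ... | true rewrite ≡ˡ?-sound x a e | qa = refl
  ... | false with q x
  ...   | true  = refl
  ...   | false = refl


at-applyUpTo : ∀ (f : ℕ → ℕ) n a → a < n → at (applyUpTo f n) a ≡ f a
at-applyUpTo f (suc n) zero    _         = refl
at-applyUpTo f (suc n) (suc a) (s≤s a<n) = at-applyUpTo (f ∘ suc) n a a<n

at-upTo : ∀ n a → a < n → at (upTo n) a ≡ a
at-upTo = at-applyUpTo (λ x → x)

at-map : ∀ (f : ℕ → ℕ) xs a → a < length xs → at (map f xs) a ≡ f (at xs a)
at-map f (x ∷ xs) zero    _        = refl
at-map f (x ∷ xs) (suc a) (s≤s a<) = at-map f xs a a<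

map-at-upTo : ∀ qs → map (at qs) (upTo (length qs)) ≡ qs
map-at-upTo qs = trans (LP.map-upTo (at qs) (length qs)) (applyUpTo-at qs)
  where
  applyUpTo-at : ∀ qs → applyUpTo (at qs) (length qs) ≡ qs
  applyUpTo-at []       = refl
  applyUpTo-at (q ∷ qs) = cong (q ∷_) (applyUpTo-at qs)

at-∈ : ∀ xs a → a < length xs → at xs a ∈ xs
at-∈ (x ∷ xs) zero    _        = here refl
at-∈ (x ∷ xs) (suc a) (s≤s a<) = there (at-∈ xs a a<)

at-ext : ∀ (σ τ : List ℕ) → length σ ≡ length τ → (∀ a → a < length σ → at σ a ≡ at τ a) → σ ≡ τ
at-ext []      []      _ _ = refl
at-ext (x ∷ σ) (y ∷ τ) e h =
  cong₂ _∷_ (h 0 (s≤s z≤n)) (at-ext σ τ (ℕP.suc-injective e) (λ a a< → h (suc a) (s≤s a<)))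

choose-length : ∀ k xs {ys} → ys ∈ choose k xs → length ys ≡ k
choose-length zero    xs       (here refl) = refl
choose-length (suc k) (x ∷ xs) m with MP.∈-++⁻ (map (x ∷_) (choose k xs)) m
... | inj₂ m′ = choose-length (suc k) xs m′
... | inj₁ m′ with MP.∈-map⁻ (x ∷_) m′
...   | zs , zm , refl = cong suc (choose-length k xs zm)

choose-≤ : ∀ k xs {ys} → ys ∈ choose k xs → k ≤ length xs
choose-≤ zero    xs       _ = z≤n
choose-≤ (suc k) (x ∷ xs) m with MP.∈-++⁻ (map (x ∷_) (choose k xs)) m
... | inj₂ m′ = ℕP.m≤n⇒m≤1+n (choose-≤ (suc k) xs m′)
... | inj₁ m′ with MP.∈-map⁻ (x ∷_) m′
...   | zs , zm , refl = s≤s (choose-≤ k xs zm)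

choose-⊆ : ∀ k xs {ys y} → ys ∈ choose k xs → y ∈ ys → y ∈ xs
choose-⊆ zero    xs       (here refl) ()
choose-⊆ (suc k) (x ∷ xs) m ym with MP.∈-++⁻ (map (x ∷_) (choose k xs)) m
... | inj₂ m′ = there (choose-⊆ (suc k) xs m′ ym)
... | inj₁ m′ with MP.∈-map⁻ (x ∷_) m′
choose-⊆ (suc k) (x ∷ xs) m (here refl) | inj₁ m′ | zs , zm , refl = here refl
choose-⊆ (suc k) (x ∷ xs) m (there ym)  | inj₁ m′ | zs , zm , refl = there (choose-⊆ k xs zm ym)

choose-too-long : ∀ k xs → length xs < k → choose k xs ≡ []
choose-too-long (suc k) []       _        = refl
choose-too-long (suc k) (x ∷ xs) (s≤s lt)
  rewrite choose-too-long k xs lt | choose-too-long (suc k) xs (ℕP.m<n⇒m<1+n lt) = refl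

choose-self : ∀ xs → choose (length xs) xs ≡ xs ∷ []
choose-self []       = refl
choose-self (x ∷ xs) rewrite choose-self xs | choose-too-long (suc (length xs)) xs ℕP.≤-refl = refl

choose-upTo-self : ∀ n → choose n (upTo n) ≡ upTo n ∷ []
choose-upTo-self n = subst (λ k → choose k (upTo n) ≡ upTo n ∷ []) (LP.length-upTo n) (choose-self (upTo n))

choose-map : ∀ (f : ℕ → ℕ) k xs → choose k (map f xs) ≡ map (map f) (choose k xs)
choose-map f zero    xs       = refl
choose-map f (suc k) []       = refl
choose-map f (suc k) (x ∷ xs)
  rewrite choose-map f k xs | choose-map f (suc k) xs
        | LP.map-++ (map f) (map (x ∷_) (choose k xs)) (choose (suc k) xs)
        | sym (LP.map-∘ {g = map f} {f = x ∷_} (choose k xs))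
        | sym (LP.map-∘ {g = f x ∷_} {f = map f} (choose k xs)) = refl

choose-trans : ∀ m xs k {ys zs} → ys ∈ choose m xs → zs ∈ choose k ys → zs ∈ choose k xs
choose-trans zero    xs       zero    (here refl) (here refl) = here refl
choose-trans (suc m) (x ∷ xs) k ym zm with MP.∈-++⁻ (map (x ∷_) (choose m xs)) ym
... | inj₂ ym′ = skip k (choose-trans (suc m) xs k ym′ zm)
  where
  skip : ∀ k {zs} → zs ∈ choose k xs → zs ∈ choose k (x ∷ xs)
  skip zero    (here refl) = here refl
  skip (suc k) m′          = MP.∈-++⁺ʳ (map (x ∷_) (choose k xs)) m′
... | inj₁ ym′ with MP.∈-map⁻ (x ∷_) ym′
choose-trans (suc m) (x ∷ xs) zero    ym (here refl) | inj₁ ym′ | ys′ , ysm , refl = here refl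
choose-trans (suc m) (x ∷ xs) (suc k) ym zm          | inj₁ ym′ | ys′ , ysm , refl
  with MP.∈-++⁻ (map (x ∷_) (choose k ys′)) zm
... | inj₂ zm′ = MP.∈-++⁺ʳ (map (x ∷_) (choose k xs)) (choose-trans m xs (suc k) ysm zm′)
... | inj₁ zm′ with MP.∈-map⁻ (x ∷_) zm′
...   | zs′ , zsm , refl = MP.∈-++⁺ˡ (MP.∈-map⁺ (x ∷_) (choose-trans m xs k ysm zsm))

and-true⁻ : ∀ (L : List Bool) {b} → and L ≡ true → b ∈ L → b ≡ true
and-true⁻ (true ∷ L) h (here refl) = refl
and-true⁻ (true ∷ L) h (there m)   = and-true⁻ L h m

and-true⁺ : ∀ (L : List Bool) → (∀ b → b ∈ L → b ≡ true) → and L ≡ true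
and-true⁺ []      h = refl
and-true⁺ (b ∷ L) h rewrite h b (here refl) = and-true⁺ L (λ c m → h c (there m))

==ᵇ-sound : ∀ x y → (x ==ᵇ y) ≡ true → x ≡ y
==ᵇ-sound true  y     h = sym h
==ᵇ-sound false false h = refl

==ᵇ-refl : ∀ x → (x ==ᵇ x) ≡ true
==ᵇ-refl true  = refl
==ᵇ-refl false = refl

OrderPreserving : List ℕ → List ℕ → List ℕ → Set
OrderPreserving τ π ps = ∀ a b → a < length τ → b < length τ →
  (at τ a <ᵇ at τ b) ≡ (at π (at ps a) <ᵇ at π (at ps b))

orderTest : List ℕ → List ℕ → List ℕ → ℕ → ℕ → Bool
orderTest τ π ps a b = (at τ a <ᵇ at τ b) ==ᵇ (at π (at ps a) <ᵇ at π (at ps b))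

isEmb⇒order : ∀ τ π ps → isEmb τ π ps ≡ true → OrderPreserving τ π ps
isEmb⇒order τ π ps h a b a< b< =
  ==ᵇ-sound _ _ (and-true⁻ _ h (MP.∈-concatMap⁺ row (Any.map (λ { refl → b-in-row }) (MP.∈-upTo⁺ a<))))
  where
  row : ℕ → List Bool
  row a = map (orderTest τ π ps a) (upTo (length τ))
  b-in-row = MP.∈-map⁺ (orderTest τ π ps a) (MP.∈-upTo⁺ b<)

order⇒isEmb : ∀ τ π ps → OrderPreserving τ π ps → isEmb τ π ps ≡ true
order⇒isEmb τ π ps h = and-true⁺ _ λ c m → entry c (find (MP.∈-concatMap⁻ row m))
  where
  row : ℕ → List Bool
  row a = map (orderTest τ π ps a) (upTo (length τ))
  entry : ∀ c → Σ ℕ (λ a → a ∈ upTo (length τ) × c ∈ row a) → c ≡ true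
  entry c (a , am , cm) with MP.∈-map⁻ _ cm
  ... | b , bm , refl
    rewrite h a b (MP.∈-upTo⁻ am) (MP.∈-upTo⁻ bm) = ==ᵇ-refl (at π (at ps a) <ᵇ at π (at ps b))

embs⁻ : ∀ τ π {ps} → ps ∈ embs τ π →
  ps ∈ choose (length τ) (upTo (length π)) × OrderPreserving τ π ps
embs⁻ τ π {ps} m = map₂ (isEmb⇒order τ π ps) (∈-filterᵇ⁻ (isEmb τ π) m)

embs⁺ : ∀ τ π {ps} → ps ∈ choose (length τ) (upTo (length π)) → OrderPreserving τ π ps → ps ∈ embs τ π
embs⁺ τ π {ps} m o = ∈-filterᵇ⁺ (isEmb τ π) m (order⇒isEmb τ π ps o)

≤ᵇ⇒emb : ∀ σ π → (σ ≤ᵇ π) ≡ true → Σ (List ℕ) (λ ps → ps ∈ embs σ π)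
≤ᵇ⇒emb σ π h with embs σ π
... | ps ∷ _ = ps , here refl

emb⇒≤ᵇ : ∀ σ π {ps} → ps ∈ embs σ π → (σ ≤ᵇ π) ≡ true
emb⇒≤ᵇ σ π m with embs σ π
... | _ ∷ _ = refl

≤ᵇ-length : ∀ σ π → (σ ≤ᵇ π) ≡ true → length σ ≤ length π
≤ᵇ-length σ π h with ≤ᵇ⇒emb σ π h
... | ps , m = subst (length σ ≤_) (LP.length-upTo (length π))
                 (choose-≤ (length σ) (upTo (length π)) (proj₁ (embs⁻ σ π m)))

identity-order : ∀ π → OrderPreserving π π (upTo (length π))
identity-order π a b a< b< = sym (cong₂ (λ x y → at π x <ᵇ at π y) (at-upTo _ a a<) (at-upTo _ b b<))

embs-self : ∀ π → embs π π ≡ upTo (length π) ∷ []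
embs-self π rewrite choose-upTo-self (length π) | filterᵇ-cons (isEmb π π) (upTo (length π)) []
                  | order⇒isEmb π π (upTo (length π)) (identity-order π) = refl

≤ᵇ-refl : ∀ π → (π ≤ᵇ π) ≡ true
≤ᵇ-refl π rewrite embs-self π = refl

-- Containment is transitive: compose the position lists, ps then qs.
≤ᵇ-trans : ∀ σ ρ τ → (σ ≤ᵇ ρ) ≡ true → (ρ ≤ᵇ τ) ≡ true → (σ ≤ᵇ τ) ≡ true
≤ᵇ-trans σ ρ τ σ≤ρ ρ≤τ with ≤ᵇ⇒emb σ ρ σ≤ρ | ≤ᵇ⇒emb ρ τ ρ≤τ
... | ps , pm | qs , qm = emb⇒≤ᵇ σ τ (embs⁺ σ τ composite-sublist composite-order)
  where
  ps-sub = proj₁ (embs⁻ σ ρ pm)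
  qs-sub = proj₁ (embs⁻ ρ τ qm)
  |qs| : length qs ≡ length ρ
  |qs| = choose-length _ _ qs-sub
  a<|ps| : ∀ {a} → a < length σ → a < length ps
  a<|ps| {a} = subst (a <_) (sym (choose-length _ _ ps-sub))
  ps-bound : ∀ a → a < length σ → at ps a < length ρ
  ps-bound a a< = MP.∈-upTo⁻ (choose-⊆ (length σ) (upTo (length ρ)) ps-sub (at-∈ ps a (a<|ps| a<)))
  composite-sublist : map (at qs) ps ∈ choose (length σ) (upTo (length τ))
  composite-sublist = choose-trans (length ρ) (upTo (length τ)) (length σ) qs-sub
    (subst (λ l → map (at qs) ps ∈ choose (length σ) l) (map-at-upTo qs)
      (subst (map (at qs) ps ∈_) (sym (choose-map (at qs) (length σ) (upTo (length qs))))
        (MP.∈-map⁺ (map (at qs)) (subst (λ k → ps ∈ choose (length σ) (upTo k)) (sym |qs|) ps-sub))))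
  composite-order : OrderPreserving σ τ (map (at qs) ps)
  composite-order a b a< b< =
    trans (proj₂ (embs⁻ σ ρ pm) a b a< b<)
     (trans (proj₂ (embs⁻ ρ τ qm) (at ps a) (at ps b) (ps-bound a a<) (ps-bound b b<))
       (sym (cong₂ (λ x y → at τ x <ᵇ at τ y) (at-map (at qs) ps a (a<|ps| a<)) (at-map (at qs) ps b (a<|ps| b<)))))

PermOf : ℕ → List ℕ → Set
PermOf n σ = σ ↭ upTo n

PermOf-length : ∀ n σ → PermOf n σ → length σ ≡ n
PermOf-length n σ h = trans (PP.↭-length h) (LP.length-upTo n)

PermOf-entry< : ∀ n σ → PermOf n σ → ∀ a → a < length σ → at σ a < n
PermOf-entry< n σ h a a< = MP.∈-upTo⁻ (PP.∈-resp-↭ h (at-∈ σ a a<))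

count<-upTo : ∀ v n → length (filterᵇ (_<ᵇ v) (upTo n)) ≡ v ⊓ n
count<-upTo v zero    = sym (ℕP.⊓-zeroʳ v)
count<-upTo v (suc n) = begin
  length (filterᵇ (_<ᵇ v) (upTo (suc n)))
    ≡⟨ cong (λ l → length (filterᵇ (_<ᵇ v) l)) (sym (LP.upTo-∷ʳ n)) ⟩
  length (filterᵇ (_<ᵇ v) (upTo n ++ n ∷ []))
    ≡⟨ cong length (LP.filter-++ (T? ∘ (_<ᵇ v)) (upTo n) (n ∷ [])) ⟩
  length (filterᵇ (_<ᵇ v) (upTo n) ++ filterᵇ (_<ᵇ v) (n ∷ []))
    ≡⟨ LP.length-++ (filterᵇ (_<ᵇ v) (upTo n)) ⟩
  length (filterᵇ (_<ᵇ v) (upTo n)) + length (filterᵇ (_<ᵇ v) (n ∷ []))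
    ≡⟨ cong₂ _+_ (count<-upTo v n) (trans (length-filterᵇ-cons (_<ᵇ v) n []) (ℕP.+-identityʳ _)) ⟩
  v ⊓ n + (if n <ᵇ v then 1 else 0)
    ≡⟨ ⊓-step v n ⟩
  v ⊓ suc n ∎
  where
  open ≡-Reasoning
  ⊓-step : ∀ v n → v ⊓ n + (if n <ᵇ v then 1 else 0) ≡ v ⊓ suc n
  ⊓-step zero    n       = refl
  ⊓-step (suc v) zero    rewrite ℕP.⊓-zeroʳ v = refl
  ⊓-step (suc v) (suc n) = cong suc (⊓-step v n)

PermOf-count< : ∀ n σ → PermOf n σ → ∀ v → v ≤ n → length (filterᵇ (_<ᵇ v) σ) ≡ v
PermOf-count< n σ h v v≤n = trans (PP.↭-length (PP.filter-↭ (T? ∘ (_<ᵇ v)) h))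
  (trans (count<-upTo v n) (ℕP.m≤n⇒m⊓n≡m v≤n))

count<-positions : ∀ (σ : List ℕ) v →
  length (filterᵇ (λ b → at σ b <ᵇ v) (upTo (length σ))) ≡ length (filterᵇ (_<ᵇ v) σ)
count<-positions σ v = trans (sym (length-filterᵇ-map (_<ᵇ v) (at σ) (upTo (length σ))))
  (cong (λ l → length (filterᵇ (_<ᵇ v) l)) (map-at-upTo σ))

-- A permutation is determined by its pattern: each entry equals the number
-- of entries below it, and that number is read off from the relative order.
same-pattern⇒≡ : ∀ n σ τ → PermOf n σ → PermOf n τ →
  (∀ a b → a < n → b < n → (at σ a <ᵇ at σ b) ≡ (at τ a <ᵇ at τ b)) → σ ≡ τ
same-pattern⇒≡ n σ τ hσ hτ same = at-ext σ τ |σ|≡|τ| entry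
  where
  open ≡-Reasoning
  |σ| = PermOf-length n σ hσ
  |τ| = PermOf-length n τ hτ
  |σ|≡|τ| = trans |σ| (sym |τ|)
  entry : ∀ a → a < length σ → at σ a ≡ at τ a
  entry a a<|σ| = begin
    at σ a
      ≡⟨ sym (PermOf-count< n σ hσ (at σ a) (ℕP.<⇒≤ (PermOf-entry< n σ hσ a a<|σ|))) ⟩
    length (filterᵇ (_<ᵇ at σ a) σ)
      ≡⟨ sym (count<-positions σ (at σ a)) ⟩
    length (filterᵇ (λ b → at σ b <ᵇ at σ a) (upTo (length σ)))
      ≡⟨ cong (λ k → length (filterᵇ (λ b → at σ b <ᵇ at σ a) (upTo k))) |σ|≡|τ| ⟩
    length (filterᵇ (λ b → at σ b <ᵇ at σ a) (upTo (length τ)))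
      ≡⟨ cong length (filterᵇ-cong _ _ (upTo (length τ))
           (λ b bm → same b a (subst (b <_) |τ| (MP.∈-upTo⁻ bm)) a<n)) ⟩
    length (filterᵇ (λ b → at τ b <ᵇ at τ a) (upTo (length τ)))
      ≡⟨ count<-positions τ (at τ a) ⟩
    length (filterᵇ (_<ᵇ at τ a) τ)
      ≡⟨ PermOf-count< n τ hτ (at τ a) (ℕP.<⇒≤ (PermOf-entry< n τ hτ a (subst (a <_) (sym |τ|) a<n))) ⟩
    at τ a ∎
    where
    a<n = subst (a <_) |σ| a<|σ|

≤ᵇ-same-length⇒≡ : ∀ n σ τ → PermOf n σ → PermOf n τ → (σ ≤ᵇ τ) ≡ true → σ ≡ τ
≤ᵇ-same-length⇒≡ n σ τ hσ hτ σ≤τ with ≤ᵇ⇒emb σ τ σ≤τ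
... | ps , pm = same-pattern⇒≡ n σ τ hσ hτ λ a b a<n b<n →
      trans (proj₂ (embs⁻ σ τ pm) a b (<|σ| a<n) (<|σ| b<n))
            (cong₂ (λ x y → at τ x <ᵇ at τ y) (identity-at a a<n) (identity-at b b<n))
  where
  <|σ| : ∀ {a} → a < n → a < length σ
  <|σ| {a} = subst (a <_) (sym (PermOf-length n σ hσ))
  -- the only length-n sublist of upTo n is upTo n itself
  ps≡id : ps ≡ upTo n
  ps≡id with subst₂ (λ k l → ps ∈ choose k (upTo l)) (PermOf-length n σ hσ) (PermOf-length n τ hτ)
                    (proj₁ (embs⁻ σ τ pm))
  ... | m rewrite choose-upTo-self n with m
  ...   | here e = e
  identity-at : ∀ a → a < n → at ps a ≡ a
  identity-at a a<n = trans (cong (λ l → at l a) ps≡id) (at-upTo n a a<n)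

insertions-↭ : ∀ k x y → y ∈ insertions k x → y ↭ k ∷ x
insertions-↭ k []       y (here refl) = ↭-refl
insertions-↭ k (z ∷ zs) y (here refl) = ↭-refl
insertions-↭ k (z ∷ zs) y (there m) with MP.∈-map⁻ (z ∷_) m
... | y′ , ym , refl = ↭-trans (prep z (insertions-↭ k zs y′ ym)) (swap z k ↭-refl)

perms-PermOf : ∀ k x → x ∈ perms k → PermOf k x
perms-PermOf zero    x (here refl) = ↭-refl
perms-PermOf (suc k) y m with find (MP.∈-concatMap⁻ (insertions k) m)
... | x , xm , ym = ↭-trans (insertions-↭ k x y ym)
  (↭-trans (prep k (perms-PermOf k x xm)) (subst (k ∷ upTo k ↭_) (LP.upTo-∷ʳ k) (PP.∷↭∷ʳ k (upTo k))))

perms-length : ∀ k x → x ∈ perms k → length x ≡ k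
perms-length k x m = PermOf-length k x (perms-PermOf k x m)

permsBelow⁻ : ∀ m x → x ∈ permsBelow m → length x < m × IsPerm x
permsBelow⁻ m x xm with find (MP.∈-concatMap⁻ perms xm)
... | k , km , xk rewrite perms-length k x xk = MP.∈-upTo⁻ km , perms-PermOf k x xk

mult-map-∷ : ∀ z w r L → mult (w ∷ r) (map (z ∷_) L) ≡ when (does (z ℕP.≟ w)) (mult r L)
mult-map-∷ z w r [] with does (z ℕP.≟ w)
... | true  = refl
... | false = refl
mult-map-∷ z w r (y ∷ L) rewrite mult-map-∷ z w r L with does (z ℕP.≟ w)
... | true  = refl
... | false = refl

mult-insertions : ∀ k x ws xs → k ∉ x → k ∉ ws ++ xs →
  mult (ws ++ k ∷ xs) (insertions k x) ≡ when (x ≡ˡ? (ws ++ xs)) (+ 1)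
mult-insertions k [] [] [] _ _ rewrite ≡ˡ?-complete {k ∷ []} refl = refl
mult-insertions k [] [] (y ∷ ys) _ _ rewrite ≡ˡ?-false {k ∷ []} {k ∷ y ∷ ys} (λ ()) = refl
mult-insertions k [] (w ∷ ws) xs _ _
  rewrite ≡ˡ?-false {k ∷ []} {w ∷ ws ++ k ∷ xs}
            (λ e → case LP.++-conicalʳ ws (k ∷ xs) (sym (proj₂ (LP.∷-injective e))) of λ ()) = refl
mult-insertions k (z ∷ zs) [] xs k∉x k∉
  rewrite dec-true (k ℕP.≟ k) refl | mult-map-∷ z k xs (insertions k zs)
        | dec-false (z ℕP.≟ k) (λ e → k∉x (here (sym e))) = ZP.+-identityʳ _
mult-insertions k (z ∷ zs) (w ∷ ws) xs k∉x k∉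
  rewrite dec-false (k ℕP.≟ w) (λ e → k∉ (here e)) | mult-map-∷ z w (ws ++ k ∷ xs) (insertions k zs)
        | mult-insertions k zs ws xs (λ m → k∉x (there m)) (λ m → k∉ (there m)) with does (z ℕP.≟ w)
... | true  = ZP.+-identityˡ _
... | false = refl

-- Every permutation of length k occurs exactly once in perms k: remove the
-- largest entry k and use induction.
mult-perms : ∀ k ρ → PermOf k ρ → mult ρ (perms k) ≡ + 1
mult-perms zero ρ h with PP.↭-length h
mult-perms zero [] h | _ = refl
mult-perms (suc k) ρ h with MP.∈-∃++ (PP.∈-resp-↭ (↭-sym h) (MP.∈-upTo⁺ {suc k} {k} ℕP.≤-refl))
... | ws , xs , refl =
  trans (∑-concatMap (insertions k) (perms k) (λ x → when (x ≡ˡ? ρ) (+ 1)))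
        (collapse₁ ρ′ (perms k) _ (+ 1) (mult-perms k ρ′ ρ′-perm)
          (λ x xm → mult-insertions k x ws xs (k∉ x (perms-PermOf k x xm)) (k∉ ρ′ ρ′-perm)))
  where
  ρ′ = ws ++ xs
  ρ′-perm : PermOf k ρ′
  ρ′-perm = ↭-trans (PP.drop-mid ws (upTo k) (subst (ws ++ (k ∷ []) ++ xs ↭_) (sym (LP.upTo-∷ʳ k)) h))
                    (↭-reflexive (LP.++-identityʳ (upTo k)))
  k∉ : ∀ y → PermOf k y → k ∉ y
  k∉ y hy m = ℕP.<-irrefl refl (MP.∈-upTo⁻ (PP.∈-resp-↭ hy m))

∑-upTo-indicator : ∀ m a (c : ℤ) → a < m → ∑ (upTo m) (λ k → when (does (k ℕP.≟ a)) c) ≡ c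
∑-upTo-indicator (suc m) a c a<1+m =
  trans (cong (λ l → ∑ l F) (sym (LP.upTo-∷ʳ m)))
        (trans (∑-++ (upTo m) (m ∷ []) F) (last-or-earlier (ℕP.m≤n⇒m<n∨m≡n (ℕP.≤-pred a<1+m))))
  where
  F = λ k → when (does (k ℕP.≟ a)) c
  last-or-earlier : a < m ⊎ a ≡ m → ∑ (upTo m) F +ℤ ∑ (m ∷ []) F ≡ c
  last-or-earlier (inj₁ a<m)
    rewrite ∑-upTo-indicator m a c a<m | dec-false (m ℕP.≟ a) (λ e → ℕP.<-irrefl (sym e) a<m) =
    ZP.+-identityʳ _
  last-or-earlier (inj₂ refl)
    rewrite dec-true (m ℕP.≟ m) refl
          | ∑-zero (upTo m) {F} (λ k km → cong (λ b → when b c) (dec-false (k ℕP.≟ m) (ℕP.<⇒≢ (MP.∈-upTo⁻ km)))) =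
    trans (ZP.+-identityˡ _) (ZP.+-identityʳ _)

mult-permsBelow : ∀ m ρ → IsPerm ρ → length ρ < m → mult ρ (permsBelow m) ≡ + 1
mult-permsBelow m ρ h |ρ|<m =
  trans (∑-concatMap perms (upTo m) (λ x → when (x ≡ˡ? ρ) (+ 1)))
        (trans (∑-cong (upTo m) (λ k _ → mult-perms-length k)) (∑-upTo-indicator m (length ρ) (+ 1) |ρ|<m))
  where
  mult-perms-length : ∀ k → mult ρ (perms k) ≡ when (does (k ℕP.≟ length ρ)) (+ 1)
  mult-perms-length k with k ℕP.≟ length ρ
  ... | yes refl = trans (mult-perms k ρ h) (cong (λ b → when b (+ 1)) (sym (dec-true (k ℕP.≟ k) refl)))
  ... | no k≢|ρ| = trans (∑-zero (perms k) (λ x xm → cong (λ b → when b (+ 1))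
                       (≡ˡ?-false {x} {ρ} (λ e → k≢|ρ| (trans (sym (perms-length k x xm)) (cong length e))))))
                     (cong (λ b → when b (+ 1)) (sym (dec-false (k ℕP.≟ length ρ) k≢|ρ|)))

between : List ℕ → List ℕ → List ℕ → Bool
between l u τ = (l ≤ᵇ τ) ∧ (τ ≤ᵇ u)

belowSum : List ℕ → List ℕ → ℤ
belowSum σ τ = ∑ (filterᵇ (between σ τ) (permsBelow (length τ))) (μ σ)

mobF-fuel : ∀ f g σ τ → length τ < f → length τ < g → mobF f σ τ ≡ mobF g σ τ
mobF-fuel (suc f) (suc g) σ τ |τ|<1+f |τ|<1+g =
  cong (λ X → if σ ≡ˡ? τ then + 1 else if σ ≤ᵇ τ then - X else + 0)
    (∑-cong (filterᵇ (between σ τ) (permsBelow (length τ))) λ x xm →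
      let |x|<|τ| = proj₁ (permsBelow⁻ (length τ) x (proj₁ (∈-filterᵇ⁻ (between σ τ) xm)))
      in mobF-fuel f g σ x (ℕP.<-≤-trans |x|<|τ| (ℕP.≤-pred |τ|<1+f)) (ℕP.<-≤-trans |x|<|τ| (ℕP.≤-pred |τ|<1+g)))

μ-unfold : ∀ σ τ → μ σ τ ≡ (if σ ≡ˡ? τ then + 1 else if σ ≤ᵇ τ then - belowSum σ τ else + 0)
μ-unfold σ τ =
  cong (λ X → if σ ≡ˡ? τ then + 1 else if σ ≤ᵇ τ then - X else + 0)
    (∑-cong (filterᵇ (between σ τ) (permsBelow (length τ))) λ x xm →
      let |x|<|τ| = proj₁ (permsBelow⁻ (length τ) x (proj₁ (∈-filterᵇ⁻ (between σ τ) xm)))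
      in mobF-fuel (length τ) (suc (length x)) σ x |x|<|τ| ℕP.≤-refl)

-- belowSum is empty when σ = τ (nothing strictly shorter contains σ) ...
belowSum-self : ∀ σ → belowSum σ σ ≡ + 0
belowSum-self σ = ∑-zero (filterᵇ (between σ σ) (permsBelow (length σ))) λ l lm →
  let (lm′ , σ≤l≤σ) = ∈-filterᵇ⁻ (between σ σ) lm
  in ⊥-elim (ℕP.<-irrefl refl (ℕP.≤-<-trans (≤ᵇ-length σ l (proj₁ (∧-true σ≤l≤σ)))
                                             (proj₁ (permsBelow⁻ (length σ) l lm′))))

-- ... and when σ ≰ τ (by transitivity).
belowSum-≰ : ∀ σ τ → (σ ≤ᵇ τ) ≡ false → belowSum σ τ ≡ + 0
belowSum-≰ σ τ σ≰τ = ∑-zero (filterᵇ (between σ τ) (permsBelow (length τ))) λ l lm →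
  let (σ≤l , l≤τ) = ∧-true (proj₂ (∈-filterᵇ⁻ (between σ τ) {permsBelow (length τ)} lm))
  in case trans (sym (≤ᵇ-trans σ l τ σ≤l l≤τ)) σ≰τ of λ ()

-- Σ_{λ ∈ [σ,τ]} μ[σ,λ] = [τ = σ], split as (shorter λ) + (λ = τ).
μ-recursion : ∀ σ τ → belowSum σ τ +ℤ when (σ ≤ᵇ τ) (μ σ τ) ≡ when (τ ≡ˡ? σ) (+ 1)
μ-recursion σ τ rewrite μ-unfold σ τ with LP.≡-dec ℕP._≟_ σ τ
... | yes refl rewrite belowSum-self σ | ≤ᵇ-refl σ | ≡ˡ?-complete {σ} refl = refl
... | no σ≢τ rewrite ≡ˡ?-false (σ≢τ ∘ sym) with σ ≤ᵇ τ in σ≤τ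
...   | true  = ZP.+-inverseʳ (belowSum σ τ)
...   | false rewrite belowSum-≰ σ τ σ≤τ = refl

∑-permsBelow-suc : ∀ k (F : List ℕ → ℤ) →
  ∑ (permsBelow (suc k)) F ≡ ∑ (permsBelow k) F +ℤ ∑ (perms k) F
∑-permsBelow-suc k F = begin
  ∑ (permsBelow (suc k)) F             ≡⟨ ∑-concatMap perms (upTo (suc k)) F ⟩
  ∑ (upTo (suc k)) G                   ≡⟨ cong (λ l → ∑ l G) (sym (LP.upTo-∷ʳ k)) ⟩
  ∑ (upTo k ++ k ∷ []) G               ≡⟨ ∑-++ (upTo k) (k ∷ []) G ⟩
  ∑ (upTo k) G +ℤ (G k +ℤ + 0)         ≡⟨ cong₂ _+ℤ_ (sym (∑-concatMap perms (upTo k) F)) (ZP.+-identityʳ (G k)) ⟩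
  ∑ (permsBelow k) F +ℤ ∑ (perms k) F ∎
  where
  open ≡-Reasoning
  G : ℕ → ℤ
  G j = ∑ (perms j) F

∑-permsBelow-stable : ∀ k n (F : List ℕ → ℤ) → k ≤ n →
  (∀ j l → k < j → l ∈ perms j → F l ≡ + 0) →
  ∑ (permsBelow (suc n)) F ≡ ∑ (permsBelow (suc k)) F
∑-permsBelow-stable zero zero    F z≤n vanish = refl
∑-permsBelow-stable k    (suc n) F k≤1+n vanish with ℕP.m≤n⇒m<n∨m≡n k≤1+n
... | inj₂ refl = refl
... | inj₁ (s≤s k≤n) =
  trans (∑-permsBelow-suc (suc n) F)
        (trans (cong₂ _+ℤ_ (∑-permsBelow-stable k n F k≤n vanish)
                           (∑-zero (perms (suc n)) (λ l → vanish (suc n) l (s≤s k≤n))))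
               (ZP.+-identityʳ _))

-- The only permutation of length |τ| in [σ, τ] is τ itself.
∑-perms-top : ∀ σ τ → IsPerm τ →
  ∑ (perms (length τ)) (λ l → when (between σ τ l) (μ σ l)) ≡ when (σ ≤ᵇ τ) (μ σ τ)
∑-perms-top σ τ hτ = collapse₁ τ (perms (length τ)) _ _ (mult-perms (length τ) τ hτ) term
  where
  term : ∀ l → l ∈ perms (length τ) → when (between σ τ l) (μ σ l) ≡ when (l ≡ˡ? τ) (when (σ ≤ᵇ τ) (μ σ τ))
  term l lm with l ≡ˡ? τ in l≟τ
  ... | true rewrite ≡ˡ?-sound l τ l≟τ | ≤ᵇ-refl τ with σ ≤ᵇ τ
  ...   | true  = refl
  ...   | false = refl
  term l lm | false = when-∧-zero (σ ≤ᵇ l) (l ≤ᵇ τ) (μ σ l) λ { (_ , l≤τ) →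
    case trans (sym (≡ˡ?-complete (≤ᵇ-same-length⇒≡ (length τ) l τ (perms-PermOf (length τ) l lm) hτ l≤τ))) l≟τ
    of λ () }

μ-column-sum : ∀ σ τ n → IsPerm τ → length τ ≤ n →
  ∑ (permsBelow (suc n)) (λ l → when (between σ τ l) (μ σ l)) ≡ when (τ ≡ˡ? σ) (+ 1)
μ-column-sum σ τ n hτ |τ|≤n = begin
  ∑ (permsBelow (suc n)) F
    ≡⟨ ∑-permsBelow-stable (length τ) n F |τ|≤n too-long ⟩
  ∑ (permsBelow (suc (length τ))) F
    ≡⟨ ∑-permsBelow-suc (length τ) F ⟩
  ∑ (permsBelow (length τ)) F +ℤ ∑ (perms (length τ)) F
    ≡⟨ cong₂ _+ℤ_ (sym (∑-filter (between σ τ) (permsBelow (length τ)) (μ σ))) (∑-perms-top σ τ hτ) ⟩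
  belowSum σ τ +ℤ when (σ ≤ᵇ τ) (μ σ τ)
    ≡⟨ μ-recursion σ τ ⟩
  when (τ ≡ˡ? σ) (+ 1) ∎
  where
  open ≡-Reasoning
  F : List ℕ → ℤ
  F l = when (between σ τ l) (μ σ l)
  too-long : ∀ j l → length τ < j → l ∈ perms j → F l ≡ + 0
  too-long j l |τ|<j lm = when-∧-zero (σ ≤ᵇ l) (l ≤ᵇ τ) (μ σ l) λ { (_ , l≤τ) →
    ℕP.<-irrefl refl (ℕP.<-≤-trans |τ|<j (subst (_≤ length τ) (perms-length j l lm) (≤ᵇ-length l τ l≤τ))) }

interval⁻ : ∀ l u {τ} → τ ∈ interval l u → IsPerm τ × (l ≤ᵇ τ) ≡ true × (τ ≤ᵇ u) ≡ true
interval⁻ l u {τ} τm =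
  let (τU , l≤τ≤u) = ∈-filterᵇ⁻ (between l u) {permsBelow (suc (length u))} τm
  in proj₂ (permsBelow⁻ (suc (length u)) τ τU) , ∧-true l≤τ≤u

mult-interval-top : ∀ l u → IsPerm u → (l ≤ᵇ u) ≡ true → mult u (interval l u) ≡ + 1
mult-interval-top l u hu l≤u =
  trans (mult-filter (between l u) u (permsBelow (suc (length u))) (cong₂ _∧_ l≤u (≤ᵇ-refl u)))
        (mult-permsBelow (suc (length u)) u hu ℕP.≤-refl)

∑-interval-top : ∀ σ π (g : List ℕ → ℤ) → IsPerm π → (σ ≤ᵇ π) ≡ true →
  (∀ l → l ∈ interval σ π → l ≢ π → μ σ l ≢ + 0 → g l ≡ + 0) →
  ∑ (interval σ π) (λ l → μ σ l * g l) ≡ μ σ π * g π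
∑-interval-top σ π g hπ σ≤π vanish = collapse₁ π (interval σ π) _ _ (mult-interval-top σ π hπ σ≤π) term
  where
  term : ∀ l → l ∈ interval σ π → μ σ l * g l ≡ when (l ≡ˡ? π) (μ σ π * g π)
  term l lm with l ≡ˡ? π in l≟π
  ... | true rewrite ≡ˡ?-sound l π l≟π = refl
  ... | false with μ σ l ZP.≟ + 0
  ...   | yes μ≡0 rewrite μ≡0 = refl
  ...   | no μ≢0 = trans (cong (μ σ l *_) (vanish l lm (λ e → case trans (sym (≡ˡ?-complete e)) l≟π of λ ()) μ≢0))
                         (ZP.*-zeroʳ (μ σ l))

∑-interval-self : ∀ π (s : List ℕ → ℤ) → IsPerm π → ∑ (interval π π) s ≡ s π
∑-interval-self π s hπ = collapse₁ π (interval π π) s (s π) (mult-interval-top π π hπ (≤ᵇ-refl π)) term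
  where
  term : ∀ τ → τ ∈ interval π π → s τ ≡ when (τ ≡ˡ? π) (s π)
  term τ τm with interval⁻ π π τm
  ... | hτ , π≤τ , τ≤π with ℕP.≤-antisym (≤ᵇ-length τ π τ≤π) (≤ᵇ-length π τ π≤τ)
  ...   | |τ|≡|π| with ≤ᵇ-same-length⇒≡ (length τ) τ π hτ (subst (λ k → PermOf k π) (sym |τ|≡|π|) hπ) τ≤π
  ...     | refl rewrite ≡ˡ?-complete {τ} refl = refl

chain-guard : ∀ σl lπ lτ τπ (x : ℤ) → (lτ ≡ true → τπ ≡ true → lπ ≡ true) →
  when (σl ∧ lπ) (when (lτ ∧ τπ) x) ≡ when τπ (when (σl ∧ lτ) x)
chain-guard true  true  true  true  x _ = refl
chain-guard true  false true  true  x h = case h refl refl of λ ()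
chain-guard true  true  true  false x _ = refl
chain-guard true  true  false true  x _ = refl
chain-guard true  true  false false x _ = refl
chain-guard true  false true  false x _ = refl
chain-guard true  false false true  x _ = refl
chain-guard true  false false false x _ = refl
chain-guard false lπ    lτ    true  x _ = refl
chain-guard false lπ    lτ    false x _ = refl

when-*∑-when : {A : Set} → ∀ b (m : ℤ) (L : List A) (p : A → Bool) (f : A → ℤ) →
  when b (m * ∑ L (λ x → when (p x) (f x))) ≡ ∑ L (λ x → when b (when (p x) (m * f x)))
when-*∑-when b m L p f =
  trans (when-*∑ b m L _) (∑-cong L (λ x _ → cong (when b) (*-when (p x) m (f x))))

∑-chain-exchange : ∀ (U : List (List ℕ)) σ π (w s : List ℕ → ℤ) →
  ∑ (filterᵇ (between σ π) U) (λ l → w l * ∑ (filterᵇ (between l π) U) s)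
  ≡ ∑ U (λ τ → when (τ ≤ᵇ π) (s τ * ∑ U (λ l → when (between σ τ l) (w l))))
∑-chain-exchange U σ π w s = begin
  ∑ (filterᵇ (between σ π) U) (λ l → w l * ∑ (filterᵇ (between l π) U) s)
    ≡⟨ ∑-filter (between σ π) U _ ⟩
  ∑ U (λ l → when (between σ π l) (w l * ∑ (filterᵇ (between l π) U) s))
    ≡⟨ ∑-cong U (λ l _ → trans (cong (λ X → when (between σ π l) (w l * X)) (∑-filter (between l π) U s))
                                (when-*∑-when (between σ π l) (w l) U (between l π) s)) ⟩
  ∑ U (λ l → ∑ U (λ τ → when (between σ π l) (when (between l π τ) (w l * s τ))))
    ≡⟨ ∑-swap U U _ ⟩
  ∑ U (λ τ → ∑ U (λ l → when (between σ π l) (when (between l π τ) (w l * s τ))))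
    ≡⟨ ∑-cong U (λ τ _ → ∑-cong U (λ l _ →
         trans (cong (λ x → when (between σ π l) (when (between l π τ) x)) (ZP.*-comm (w l) (s τ)))
               (chain-guard (σ ≤ᵇ l) (l ≤ᵇ π) (l ≤ᵇ τ) (τ ≤ᵇ π) (s τ * w l) (≤ᵇ-trans l τ π)))) ⟩
  ∑ U (λ τ → ∑ U (λ l → when (τ ≤ᵇ π) (when (between σ τ l) (s τ * w l))))
    ≡⟨ ∑-cong U (λ τ _ → sym (when-*∑-when (τ ≤ᵇ π) (s τ) U (between σ τ) w)) ⟩
  ∑ U (λ τ → when (τ ≤ᵇ π) (s τ * ∑ U (λ l → when (between σ τ l) (w l)))) ∎
  where open ≡-Reasoning

μ-inversion : ∀ σ π (s : List ℕ → ℤ) → IsPerm σ → (σ ≤ᵇ π) ≡ true →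
  ∑ (interval σ π) (λ l → μ σ l * ∑ (interval l π) s) ≡ s σ
μ-inversion σ π s hσ σ≤π =
  trans (∑-chain-exchange U σ π (μ σ) s)
        (collapse₁ σ U _ (s σ) (mult-permsBelow (suc (length π)) σ hσ (s≤s (≤ᵇ-length σ π σ≤π))) term)
  where
  U = permsBelow (suc (length π))
  term : ∀ τ → τ ∈ U →
    when (τ ≤ᵇ π) (s τ * ∑ U (λ l → when (between σ τ l) (μ σ l))) ≡ when (τ ≡ˡ? σ) (s σ)
  term τ τU with permsBelow⁻ (suc (length π)) τ τU
  ... | |τ|<1+|π| , hτ rewrite μ-column-sum σ τ (length π) hτ (ℕP.≤-pred |τ|<1+|π|) with τ ≡ˡ? σ in τ≟σ
  ...   | true rewrite ≡ˡ?-sound τ σ τ≟σ | σ≤π = ZP.*-identityʳ (s σ)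
  ...   | false rewrite ZP.*-zeroʳ (s τ) with τ ≤ᵇ π
  ...     | true  = refl
  ...     | false = refl

sign : ℕ → ℤ
sign k = if isOdd k then - (+ 1) else + 1

sign-suc : ∀ k → sign (suc k) ≡ - sign k
sign-suc k with isOdd k
... | true  = refl
... | false = refl

sign-+ : ∀ a b → sign (a + b) ≡ sign a * sign b
sign-+ zero    b = sym (ZP.*-identityˡ _)
sign-+ (suc a) b rewrite sign-suc (a + b) | sign-suc a | sign-+ a b = ZP.neg-distribˡ-* (sign a) (sign b)

sign² : ∀ k → sign k * sign k ≡ + 1
sign² k with isOdd k
... | true  = refl
... | false = refl

-1^≡sign : ∀ k → (- (+ 1)) ^ k ≡ sign k
-1^≡sign zero    = refl
-1^≡sign (suc k) rewrite -1^≡sign k | sign-suc k = ZP.-1*i≡-i (sign k)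

sign-transfer : ∀ m n (x y : ℤ) → m ≤ n → x * sign n ≡ sign m * y → x ≡ sign (n ∸ m) * y
sign-transfer m n x y m≤n eq = begin
  x                                     ≡⟨ sym (ZP.*-identityʳ x) ⟩
  x * + 1                               ≡⟨ cong (x *_) (sym (sign² n)) ⟩
  x * (sign n * sign n)                 ≡⟨ sym (ZP.*-assoc x (sign n) (sign n)) ⟩
  x * sign n * sign n                   ≡⟨ cong₂ _*_ eq sign-n ⟩
  sign m * y * (sign m * sign (n ∸ m))  ≡⟨ regroup (sign m) y (sign (n ∸ m)) ⟩
  sign m * sign m * (sign (n ∸ m) * y)  ≡⟨ cong (_* (sign (n ∸ m) * y)) (sign² m) ⟩
  + 1 * (sign (n ∸ m) * y)              ≡⟨ ZP.*-identityˡ _ ⟩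
  sign (n ∸ m) * y                      ∎
  where
  open ≡-Reasoning
  sign-n : sign n ≡ sign m * sign (n ∸ m)
  sign-n = trans (cong sign (sym (ℕP.m+[n∸m]≡n m≤n))) (sign-+ m (n ∸ m))
  regroup : ∀ a y d → a * y * (a * d) ≡ a * a * (d * y)
  regroup = solve-∀

signedNE : (List ℕ → List ℕ → Bool) → List ℕ → List ℕ → ℤ
signedNE ne π τ = sign (length τ) * + length (NE ne τ π)

∑-signedNE : ∀ ne l π →
  ∑ (interval l π) (signedNE ne π) ≡ - (+ NEoddCount ne l π) +ℤ + NEevenCount ne l π
∑-signedNE ne l π = begin
  ∑ I (signedNE ne π)
    ≡⟨ ∑-cong I (λ τ _ → by-parity τ) ⟩
  ∑ I (λ τ → when (odd τ) (- N τ) +ℤ when (not (odd τ)) (N τ))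
    ≡⟨ ∑-+ I _ _ ⟩
  ∑ I (λ τ → when (odd τ) (- N τ)) +ℤ ∑ I (λ τ → when (not (odd τ)) (N τ))
    ≡⟨ cong₂ _+ℤ_ (sym (∑-filter odd I (λ τ → - N τ))) (sym (∑-filter (not ∘ odd) I N)) ⟩
  ∑ (filterᵇ odd I) (λ τ → - N τ) +ℤ ∑ (filterᵇ (not ∘ odd) I) N
    ≡⟨ cong₂ _+ℤ_ (trans (∑-neg (filterᵇ odd I) N) (cong -_ (sym (+sum≡∑ (filterᵇ odd I) |NE|))))
                  (sym (+sum≡∑ (filterᵇ (not ∘ odd) I) |NE|)) ⟩
  - (+ NEoddCount ne l π) +ℤ + NEevenCount ne l π ∎
  where
  open ≡-Reasoning
  I = interval l π
  odd : List ℕ → Bool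
  odd τ = isOdd (length τ)
  |NE| : List ℕ → ℕ
  |NE| τ = length (NE ne τ π)
  N : List ℕ → ℤ
  N τ = + |NE| τ
  by-parity : ∀ τ → signedNE ne π τ ≡ when (odd τ) (- N τ) +ℤ when (not (odd τ)) (N τ)
  by-parity τ with odd τ
  ... | true  = trans (ZP.-1*i≡-i (N τ)) (sym (ZP.+-identityʳ _))
  ... | false = ZP.*-identityˡ _

NE-self : ∀ ne π → (∀ e → e ∈ embs π π → ne π e ≡ true) → length (NE ne π π) ≡ 1
NE-self ne π all-normal
  rewrite embs-self π | filterᵇ-cons (ne π) (upTo (length π)) []
        | all-normal (upTo (length π)) (here refl) = refl

proposition2p5 : (σ π : List ℕ) → IsPerm σ → IsPerm π → σ ≼ π →
    (ne : List ℕ → List ℕ → Bool) →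
    (∀ e → e ∈ embs π π → ne π e ≡ true) →
    (∀ λ′ → IsPerm λ′ → σ ≼ λ′ → λ′ ≼ π → ¬ (λ′ ≡ π) → μ σ λ′ ≢ + 0 →
    NEoddCount ne λ′ π ≡ NEevenCount ne λ′ π) →
    μ σ π ≡ ((- (+ 1)) ^ (length π ∸ length σ)) * (+ (length (NE ne σ π)))
proposition2p5 σ π hσ hπ σ≼π ne all-normal balanced =
  trans (sign-transfer (length σ) (length π) (μ σ π) |NEσ| (≤ᵇ-length σ π σ≤π) inverted)
        (cong (_* |NEσ|) (sym (-1^≡sign (length π ∸ length σ))))
  where
  open ≡-Reasoning
  σ≤π = T→≡ σ≼π
  |NEσ| = + length (NE ne σ π)
  g : List ℕ → ℤ
  g l = ∑ (interval l π) (signedNE ne π)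
  -- NE(π,π) is the identity alone, so g(π) = s(π) = (-1)^|π|
  g-top : g π ≡ sign (length π)
  g-top = trans (∑-interval-self π (signedNE ne π) hπ)
                (trans (cong (λ k → sign (length π) * + k) (NE-self ne π all-normal)) (ZP.*-identityʳ _))
  g-balanced : ∀ l → l ∈ interval σ π → l ≢ π → μ σ l ≢ + 0 → g l ≡ + 0
  g-balanced l lm l≢π μ≢0 with interval⁻ σ π lm
  ... | hl , σ≤l , l≤π = trans (∑-signedNE ne l π)
        (trans (cong (λ k → - (+ k) +ℤ + NEevenCount ne l π) (balanced l hl (≡→T σ≤l) (≡→T l≤π) l≢π μ≢0)) (ZP.+-inverseˡ (+ NEevenCount ne l π)))
  inverted : μ σ π * sign (length π) ≡ sign (length σ) * |NEσ|
  inverted = begin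
    μ σ π * sign (length π)                 ≡⟨ cong (μ σ π *_) (sym g-top) ⟩
    μ σ π * g π                             ≡⟨ sym (∑-interval-top σ π g hπ σ≤π g-balanced) ⟩
    ∑ (interval σ π) (λ l → μ σ l * g l)    ≡⟨ μ-inversion σ π (signedNE ne π) hσ σ≤π ⟩
    signedNE ne π σ                         ∎
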